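{- Let $(G,k)$ be an instance of diamond-free editing, $E_\pm=E_+\cup E_-$ a minimum solution of it, and $K$ a maximal clique of type II in $G$. Suppose $E_+$ contains neither (i) an edge between a vertex $u\in K$ and a vertex $v\in N(K)$, nor (ii) two edges joining vertices of $K$ to the same vertex of $V(G)\setminus K$. Then $K$ is a maximal clique of type II in $G\triangle E_\pm$.
   Context: Graphs are finite, simple, undirected; for $S\subseteq V(G)$, $N(S)=(\bigcup_{v\in S}N(v))\setminus S$. A diamond is $K_4$ minus one edge; diamond-free means no induced diamond. For a set $E_+$ of non-edges and a set $E_-$ of edges of $G$, $E_\pm=E_+\cup E_-$ and $G\triangle E_\pm$ is the graph on $V(G)$ with edge set $(E(G)\cup E_+)\setminus E_-$. A solution of instance $(G,k)$ is such a pair with $G\triangle E_\pm$ diamond-free and $|E_\pm|\le k$; a minimum solution minimizes $|E_\pm|$. A maximal clique is of type I if it shares at least two vertices with some other maximal clique, and of type II otherwise. -}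

module Defs where

open import Data.Nat using (ℕ; _≤_; _<ᵇ_)
open import Data.Bool using (Bool; true; false; _∧_; _∨_; not)
open import Data.Fin using (Fin; toℕ)
open import Data.Fin.Subset using (Subset; _∈_; _∉_; _⊆_)
open import Data.List using (List; length; filterᵇ; concatMap; map; allFin)
open import Data.Product using (Σ; ∃; ∃-syntax; _×_; _,_; proj₁; proj₂)
open import Relation.Nullary using (¬_)
open import Relation.Binary.PropositionalEquality using (_≡_; _≢_; refl; cong₂)

record Graph (n : ℕ) : Set where
  field
    adj    : Fin n → Fin n → Bool
    sym    : ∀ u v → adj u v ≡ adj v u
    irrefl : ∀ v → adj v v ≡ false
open Graph public

Adj : ∀ {n} → Graph n → Fin n → Fin n → Set
Adj G u v = adj G u v ≡ true

record PairSet (n : ℕ) : Set where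
  field
    mem     : Fin n → Fin n → Bool
    memSym  : ∀ u v → mem u v ≡ mem v u
    memIrr  : ∀ v → mem v v ≡ false
open PairSet public

In : ∀ {n} → PairSet n → Fin n → Fin n → Set
In S u v = mem S u v ≡ true

record Edit {n : ℕ} (G : Graph n) : Set where
  field
    plus      : PairSet n
    minus     : PairSet n
    plusNon   : ∀ u v → In plus u v → adj G u v ≡ false
    minusEdge : ∀ u v → In minus u v → Adj G u v
open Edit public

allPairs : (n : ℕ) → List (Fin n × Fin n)
allPairs n = concatMap (λ u → map (λ v → (u , v)) (allFin n)) (allFin n)

-- |E±| = |E₊ ∪ E₋|, counting each unordered pair {u,v} once (as u < v)
size : ∀ {n} {G : Graph n} → Edit G → ℕ
size {n} E = length (filterᵇ (λ p → (toℕ (proj₁ p) <ᵇ toℕ (proj₂ p))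
                                 ∧ (mem (plus E) (proj₁ p) (proj₂ p) ∨ mem (minus E) (proj₁ p) (proj₂ p)))
                             (allPairs n))

private
  xadj : ∀ {n} (G : Graph n) → Edit G → Fin n → Fin n → Bool
  xadj G E u v = (adj G u v ∨ mem (plus E) u v) ∧ not (mem (minus E) u v)

  xsym : ∀ {n} (G : Graph n) (E : Edit G) u v → xadj G E u v ≡ xadj G E v u
  xsym G E u v rewrite sym G u v | memSym (plus E) u v | memSym (minus E) u v = refl

  xirr : ∀ {n} (G : Graph n) (E : Edit G) v → xadj G E v v ≡ false
  xirr G E v rewrite irrefl G v | memIrr (plus E) v = refl

_△_ : ∀ {n} (G : Graph n) → Edit G → Graph n
G △ E = record { adj = xadj G E ; sym = xsym G E ; irrefl = xirr G E }

InducedDiamond : ∀ {n} → Graph n → Fin n → Fin n → Fin n → Fin n → Set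
InducedDiamond G a b c d =
  a ≢ b × a ≢ c × a ≢ d × b ≢ c × b ≢ d × c ≢ d ×
  Adj G a b × Adj G a c × Adj G a d × Adj G b c × Adj G b d × adj G c d ≡ false

DiamondFree : ∀ {n} → Graph n → Set
DiamondFree G = ∀ a b c d → ¬ InducedDiamond G a b c d

IsSolution : ∀ {n} (G : Graph n) (k : ℕ) → Edit G → Set
IsSolution G k E = DiamondFree (G △ E) × size E ≤ k

IsMinimumSolution : ∀ {n} (G : Graph n) (k : ℕ) → Edit G → Set
IsMinimumSolution G k E = IsSolution G k E × (∀ E′ → IsSolution G k E′ → size E ≤ size E′)

IsClique : ∀ {n} → Graph n → Subset n → Set
IsClique G K = ∀ u v → u ∈ K → v ∈ K → u ≢ v → Adj G u v

IsMaximalClique : ∀ {n} → Graph n → Subset n → Set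
IsMaximalClique G K = IsClique G K × (∀ K′ → IsClique G K′ → K ⊆ K′ → K′ ⊆ K)

TypeI : ∀ {n} → Graph n → Subset n → Set
TypeI G K = IsMaximalClique G K ×
  ∃[ K′ ] (IsMaximalClique G K′ × K′ ≢ K ×
    ∃[ u ] ∃[ v ] (u ≢ v × u ∈ K × v ∈ K × u ∈ K′ × v ∈ K′))

TypeII : ∀ {n} → Graph n → Subset n → Set
TypeII G K = IsMaximalClique G K × ¬ TypeI G K

InNbhd : ∀ {n} → Graph n → Subset n → Fin n → Set
InNbhd G S v = v ∉ S × ∃[ u ] (u ∈ S × Adj G u v)

-- Key notion: K has the one-neighbour property if no outside vertex has two
-- neighbours in K.  A maximal clique is of type II iff it has this property
-- (the forward direction extends {u, v, w} greedily to a maximal clique).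
-- Conditions (i) and (ii) carry the property from G to G △ E±.  Maximality of
-- K in G △ E± comes from two exchange arguments against minimality: undoing the
-- edit on the pairs inside K, or on the pairs at a vertex isolated in G, keeps
-- the graph diamond-free and shrinks the edit; so no edge inside K is deleted
-- and no edge is added at an isolated vertex.

module Submission where

open import Defs hiding (sym)
open import Data.Nat using (ℕ; _≤_; _<_; _<ᵇ_; s≤s; z≤n)
open import Data.Nat.Properties using (≤-trans; <⇒≤; <⇒≱; <-cmp; <⇒<ᵇ; m≤n⇒m≤1+n)
open import Data.Bool using (Bool; true; false; _∧_; _∨_; not)
open import Data.Bool.Properties
  using (∧-identityʳ; ∧-zeroʳ; ∨-identityʳ; ∨-zeroʳ; ∧-conicalˡ; ∧-distribʳ-∨; ¬-not; T-≡)
  renaming (_≟_ to _≟ᵇ_)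
open import Data.Fin using (Fin; toℕ; _≟_)
open import Data.Fin.Properties using (toℕ-injective; all?; ¬∀⟶∃¬)
open import Data.Fin.Subset using (Subset; _∈_; _∉_; _⊆_; _∪_; ⁅_⁆)
open import Data.Fin.Subset.Properties
  using (_∈?_; ⊆-antisym; x∈⁅x⁆; x∈⁅y⁆⇒x≡y; x∈p∪q⁻; p⊆p∪q; q⊆p∪q)
open import Data.List using (List; []; _∷_; length; filterᵇ; map; allFin)
open import Data.List.Membership.Propositional using () renaming (_∈_ to _∈ₗ_)
open import Data.List.Membership.Propositional.Properties using (∈-allFin; ∈-map⁺; ∈-concatMap⁺)
open import Data.List.Relation.Unary.Any using (here; there)
import Data.List.Relation.Unary.Any as Any
open import Data.Product using (∃-syntax; _×_; _,_; proj₁; proj₂; swap)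
open import Data.Sum using (_⊎_; inj₁; inj₂)
import Data.Sum as Sum
open import Data.Empty using (⊥; ⊥-elim)
open import Function using (_∘_)
open import Function.Bundles using (Equivalence; mk⇔)
open import Relation.Nullary using (¬_; Dec; yes; no; does)
open import Relation.Nullary.Decidable
  using (_→-dec_; _×-dec_; _⊎-dec_; ¬?; dec-true; dec-false; does-⇔)
open import Relation.Binary using (tri<; tri≈; tri>)
open import Relation.Binary.PropositionalEquality
  using (_≡_; _≢_; refl; sym; trans; cong; cong₂; subst)

bool-clash : ∀ {b} → b ≡ true → b ≡ false → ⊥
bool-clash refl ()

¬→-split : ∀ {A B : Set} → Dec A → ¬ (A → B) → A × ¬ B
¬→-split (yes a) ¬a→b = a , λ b → ¬a→b (λ _ → b)
¬→-split (no ¬a) ¬a→b = ⊥-elim (¬a→b (⊥-elim ∘ ¬a))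

adj-sym : ∀ {n} (G : Graph n) {a b} → Adj G a b → Adj G b a
adj-sym G {a} {b} ab = trans (Graph.sym G b a) ab

edge-origin : ∀ {n} {G : Graph n} (E : Edit G) {a b} →
              Adj (G △ E) a b → Adj G a b ⊎ In (plus E) a b
edge-origin {G = G} E {a} {b} ab with adj G a b | mem (plus E) a b | ab
... | true  | _     | _  = inj₁ refl
... | false | true  | _  = inj₂ refl
... | false | false | ()

edge-kept : ∀ {n} {G : Graph n} (E : Edit G) {a b} →
            Adj G a b → ¬ In (minus E) a b → Adj (G △ E) a b
edge-kept E {a} {b} ab ¬del with mem (minus E) a b
... | true  = ⊥-elim (¬del refl)
... | false rewrite ab = refl

∈-insert⁻ : ∀ {n} {C : Subset n} {x y : Fin n} → x ∈ C ∪ ⁅ y ⁆ → x ∈ C ⊎ x ≡ y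
∈-insert⁻ {C = C} {y = y} x∈ = Sum.map₂ (x∈⁅y⁆⇒x≡y y) (x∈p∪q⁻ C ⁅ y ⁆ x∈)

module Cliques {n : ℕ} (G : Graph n) where

  Joinable : Subset n → Fin n → Set
  Joinable C y = ∀ x → x ∈ C → x ≢ y → Adj G x y

  joinable? : ∀ C y → Dec (Joinable C y)
  joinable? C y = all? (λ x → x ∈? C →-dec ¬? (x ≟ y) →-dec adj G x y ≟ᵇ true)

  Blocked : Subset n → Fin n → Set
  Blocked C y = ∃[ x ] (x ∈ C × x ≢ y × adj G x y ≡ false)

  blocked-if-not-joinable : ∀ {C y} → ¬ Joinable C y → Blocked C y
  blocked-if-not-joinable {C} {y} ¬join
    with x , ¬joinₓ ← ¬∀⟶∃¬ n _ (λ x → x ∈? C →-dec ¬? (x ≟ y) →-dec adj G x y ≟ᵇ true) ¬join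
    with xC , ¬joinₓ′ ← ¬→-split (x ∈? C) ¬joinₓ
    with x≢y , ¬xy ← ¬→-split (¬? (x ≟ y)) ¬joinₓ′
    = x , xC , x≢y , ¬-not ¬xy

  insert-clique : ∀ {C y} → IsClique G C → Joinable C y → IsClique G (C ∪ ⁅ y ⁆)
  insert-clique {C} {y} clC join a b a∈ b∈ = pairs (∈-insert⁻ {C = C} a∈) (∈-insert⁻ {C = C} b∈)
    where
    pairs : a ∈ C ⊎ a ≡ y → b ∈ C ⊎ b ≡ y → a ≢ b → Adj G a b
    pairs (inj₁ aC)   (inj₁ bC)   a≢b = clC a b aC bC a≢b
    pairs (inj₁ aC)   (inj₂ refl) a≢b = join a aC a≢b
    pairs (inj₂ refl) (inj₁ bC)   a≢b = adj-sym G (join b bC (a≢b ∘ sym))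
    pairs (inj₂ refl) (inj₂ refl) a≢b = ⊥-elim (a≢b refl)

  singleton-clique : ∀ u → IsClique G ⁅ u ⁆
  singleton-clique u a b a∈ b∈ a≢b =
    ⊥-elim (a≢b (trans (x∈⁅y⁆⇒x≡y u a∈) (sym (x∈⁅y⁆⇒x≡y u b∈))))

  maximal-absorbs : ∀ {K y} → IsMaximalClique G K → Joinable K y → y ∈ K
  maximal-absorbs {K} {y} (clK , maxK) join =
    maxK (K ∪ ⁅ y ⁆) (insert-clique clK join) (p⊆p∪q ⁅ y ⁆) (q⊆p∪q K ⁅ y ⁆ (x∈⁅x⁆ y))

  blocked-outside : ∀ {K y} → IsMaximalClique G K → y ∉ K → Blocked K y
  blocked-outside maxK y∉K = blocked-if-not-joinable (y∉K ∘ maximal-absorbs maxK)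

  sole-vertex-isolated : ∀ {K x} → IsMaximalClique G K → (∀ v → v ∈ K → v ≡ x) →
                         ∀ z → adj G x z ≡ false
  sole-vertex-isolated {K} {x} maxK sole z = ¬-not x~z
    where
    x~z : ¬ Adj G x z
    x~z xz = bool-clash (subst (Adj G x) (sole z zK) xz) (irrefl G x)
      where
      zK : z ∈ K
      zK = maximal-absorbs maxK (λ v vK _ → subst (λ v → Adj G v z) (sym (sole v vK)) xz)

  step : Subset n → Fin n → Subset n
  step C y with joinable? C y
  ... | yes _ = C ∪ ⁅ y ⁆
  ... | no _  = C

  grow : Subset n → List (Fin n) → Subset n
  grow C []       = C
  grow C (y ∷ ys) = grow (step C y) ys

  -- After y has been offered, it is in the clique or blocked from it for good.
  Settled : Subset n → Fin n → Set
  Settled C y = y ∈ C ⊎ Blocked C y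

  settled-mono : ∀ {C D y} → C ⊆ D → Settled C y → Settled D y
  settled-mono C⊆D (inj₁ yC)                    = inj₁ (C⊆D yC)
  settled-mono C⊆D (inj₂ (x , xC , x≢y , ¬xy)) = inj₂ (x , C⊆D xC , x≢y , ¬xy)

  step-⊇ : ∀ C y → C ⊆ step C y
  step-⊇ C y with joinable? C y
  ... | yes _ = p⊆p∪q ⁅ y ⁆
  ... | no _  = λ x∈ → x∈

  step-clique : ∀ {C} y → IsClique G C → IsClique G (step C y)
  step-clique {C} y clC with joinable? C y
  ... | yes join = insert-clique clC join
  ... | no _     = clC

  step-settles : ∀ C y → Settled (step C y) y
  step-settles C y with joinable? C y
  ... | yes _     = inj₁ (q⊆p∪q C ⁅ y ⁆ (x∈⁅x⁆ y))
  ... | no ¬join = inj₂ (blocked-if-not-joinable ¬join)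

  grow-⊇ : ∀ C ys → C ⊆ grow C ys
  grow-⊇ C []       x∈ = x∈
  grow-⊇ C (y ∷ ys) x∈ = grow-⊇ (step C y) ys (step-⊇ C y x∈)

  grow-clique : ∀ {C} ys → IsClique G C → IsClique G (grow C ys)
  grow-clique []       clC = clC
  grow-clique (y ∷ ys) clC = grow-clique ys (step-clique y clC)

  grow-settles : ∀ C ys {y} → y ∈ₗ ys → Settled (grow C ys) y
  grow-settles C (y ∷ ys) (here refl) = settled-mono (grow-⊇ (step C y) ys) (step-settles C y)
  grow-settles C (_ ∷ ys) (there y∈)  = grow-settles _ ys y∈

  extend-to-maximal : ∀ {C} → IsClique G C → ∃[ T ] (IsMaximalClique G T × C ⊆ T)
  extend-to-maximal {C} clC = T , (grow-clique (allFin n) clC , maximal) , grow-⊇ C (allFin n)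
    where
    T : Subset n
    T = grow C (allFin n)
    maximal : ∀ K′ → IsClique G K′ → T ⊆ K′ → K′ ⊆ T
    maximal K′ clK′ T⊆K′ {y} yK′ with grow-settles C (allFin n) (∈-allFin y)
    ... | inj₁ yT                    = yT
    ... | inj₂ (x , xT , x≢y , ¬xy) = ⊥-elim (bool-clash (clK′ x y (T⊆K′ xT) yK′ x≢y) ¬xy)

AtMostOneNeighbourIn : ∀ {n} → Graph n → Subset n → Set
AtMostOneNeighbourIn G K =
  ∀ u v w → u ≢ v → u ∈ K → v ∈ K → w ∉ K → Adj G u w → Adj G v w → ⊥

-- A type II clique has the one-neighbour property: two neighbours u, v ∈ K of an
-- outside vertex w would give a maximal clique ⊇ {u, v, w} different from K.
typeII⇒one-neighbour : ∀ {n} {G : Graph n} {K} → TypeII G K → AtMostOneNeighbourIn G K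
typeII⇒one-neighbour {n} {G} {K} (maxK , notTypeI) u v w u≢v uK vK w∉K uw vw =
  notTypeI (maxK , T , maxT , T≢K , u , v , u≢v , uK , vK , uvw⊆T u∈uvw , uvw⊆T v∈uvw)
  where
  open Cliques G

  uvw : Subset n
  uvw = (⁅ u ⁆ ∪ ⁅ v ⁆) ∪ ⁅ w ⁆

  u∈uvw : u ∈ uvw
  u∈uvw = p⊆p∪q ⁅ w ⁆ (p⊆p∪q ⁅ v ⁆ (x∈⁅x⁆ u))

  v∈uvw : v ∈ uvw
  v∈uvw = p⊆p∪q ⁅ w ⁆ (q⊆p∪q ⁅ u ⁆ ⁅ v ⁆ (x∈⁅x⁆ v))

  w∈uvw : w ∈ uvw
  w∈uvw = q⊆p∪q (⁅ u ⁆ ∪ ⁅ v ⁆) ⁅ w ⁆ (x∈⁅x⁆ w)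

  v-joins-u : Joinable ⁅ u ⁆ v
  v-joins-u x x∈ _ rewrite x∈⁅y⁆⇒x≡y u x∈ = proj₁ maxK u v uK vK u≢v

  w-joins-uv : Joinable (⁅ u ⁆ ∪ ⁅ v ⁆) w
  w-joins-uv x x∈ _ with ∈-insert⁻ {C = ⁅ u ⁆} x∈
  ... | inj₁ x∈u  rewrite x∈⁅y⁆⇒x≡y u x∈u = uw
  ... | inj₂ refl = vw

  uvw-clique : IsClique G uvw
  uvw-clique = insert-clique (insert-clique (singleton-clique u) v-joins-u) w-joins-uv

  T : Subset n
  T = proj₁ (extend-to-maximal uvw-clique)

  maxT : IsMaximalClique G T
  maxT = proj₁ (proj₂ (extend-to-maximal uvw-clique))

  uvw⊆T : uvw ⊆ T
  uvw⊆T = proj₂ (proj₂ (extend-to-maximal uvw-clique))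

  T≢K : T ≢ K
  T≢K T≡K = w∉K (subst (w ∈_) T≡K (uvw⊆T w∈uvw))

-- Conversely, a maximal clique with the one-neighbour property is of type II:
-- a maximal clique sharing two vertices with K lies inside K, hence equals K.
one-neighbour⇒typeII : ∀ {n} {G : Graph n} {K} →
                       IsMaximalClique G K → AtMostOneNeighbourIn G K → TypeII G K
one-neighbour⇒typeII {G = G} {K} maxK one = maxK , notTypeI
  where
  notTypeI : ¬ TypeI G K
  notTypeI (_ , K′ , (clK′ , maxK′) , K′≢K , u , v , u≢v , uK , vK , uK′ , vK′) =
    K′≢K (⊆-antisym K′⊆K (maxK′ K (proj₁ maxK) K′⊆K))
    where
    K′⊆K : K′ ⊆ K
    K′⊆K {y} yK′ with y ∈? K
    ... | yes yK = yK
    ... | no y∉K = ⊥-elim (one u v y u≢v uK vK y∉K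
                     (clK′ u y uK′ yK′ (λ u≡y → y∉K (subst (_∈ K) u≡y uK)))
                     (clK′ v y vK′ yK′ (λ v≡y → y∉K (subst (_∈ K) v≡y vK))))

record PairSelection (n : ℕ) : Set₁ where
  field
    Selected  : Fin n → Fin n → Set
    selected? : ∀ a b → Dec (Selected a b)
    swap-sel  : ∀ {a b} → Selected a b → Selected b a

  keep : Fin n → Fin n → Bool
  keep a b = not (does (selected? a b))

  keep-sym : ∀ a b → keep a b ≡ keep b a
  keep-sym a b = cong not (does-⇔ (mk⇔ swap-sel swap-sel) (selected? a b) (selected? b a))
open PairSelection public

unselected : ∀ {n} → PairSet n → PairSelection n → PairSet n
unselected P S = record
  { mem    = λ a b → mem P a b ∧ keep S a b
  ; memSym = λ a b → cong₂ _∧_ (memSym P a b) (keep-sym S a b)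
  ; memIrr = λ v → cong (_∧ keep S v v) (memIrr P v)
  }

undo : ∀ {n} {G : Graph n} → Edit G → PairSelection n → Edit G
undo E S = record
  { plus      = unselected (plus E) S
  ; minus     = unselected (minus E) S
  ; plusNon   = λ a b added → plusNon E a b (∧-conicalˡ _ _ added)
  ; minusEdge = λ a b deleted → minusEdge E a b (∧-conicalˡ _ _ deleted)
  }

undo-unselected : ∀ {n} {G : Graph n} (E : Edit G) (S : PairSelection n) {a b} →
                  ¬ Selected S a b → adj (G △ undo E S) a b ≡ adj (G △ E) a b
undo-unselected E S {a} {b} ¬sel
  rewrite dec-false (selected? S a b) ¬sel
        | ∧-identityʳ (mem (plus E) a b) | ∧-identityʳ (mem (minus E) a b) = refl

undo-selected : ∀ {n} {G : Graph n} (E : Edit G) (S : PairSelection n) {a b} →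
                Selected S a b → adj (G △ undo E S) a b ≡ adj G a b
undo-selected {G = G} E S {a} {b} sel
  rewrite dec-true (selected? S a b) sel
        | ∧-zeroʳ (mem (plus E) a b) | ∧-zeroʳ (mem (minus E) a b)
        | ∨-identityʳ (adj G a b) | ∧-identityʳ (adj G a b) = refl

module _ {A : Set} (f g : A → Bool) (f⇒g : ∀ x → f x ≡ true → g x ≡ true) where

  length-filterᵇ-≤ : ∀ xs → length (filterᵇ f xs) ≤ length (filterᵇ g xs)
  length-filterᵇ-≤ []       = z≤n
  length-filterᵇ-≤ (x ∷ xs) with f x in fx | g x in gx
  ... | true  | true  = s≤s (length-filterᵇ-≤ xs)
  ... | true  | false = ⊥-elim (bool-clash (f⇒g x fx) gx)
  ... | false | true  = m≤n⇒m≤1+n (length-filterᵇ-≤ xs)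
  ... | false | false = length-filterᵇ-≤ xs

  length-filterᵇ-< : ∀ xs {y} → y ∈ₗ xs → g y ≡ true → f y ≡ false →
                     length (filterᵇ f xs) < length (filterᵇ g xs)
  length-filterᵇ-< (y ∷ xs) (here refl) gy fy rewrite gy | fy = s≤s (length-filterᵇ-≤ xs)
  length-filterᵇ-< (x ∷ xs) (there y∈) gy fy with f x in fx | g x in gx
  ... | true  | true  = s≤s (length-filterᵇ-< xs y∈ gy fy)
  ... | true  | false = ⊥-elim (bool-clash (f⇒g x fx) gx)
  ... | false | true  = m≤n⇒m≤1+n (length-filterᵇ-< xs y∈ gy fy)
  ... | false | false = length-filterᵇ-< xs y∈ gy fy

∈-allPairs : ∀ {n} (u v : Fin n) → (u , v) ∈ₗ allPairs n
∈-allPairs {n} u v =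
  ∈-concatMap⁺ (λ a → map (a ,_) (allFin n))
    (Any.map (λ { refl → ∈-map⁺ (u ,_) (∈-allFin v) }) (∈-allFin u))

touched : ∀ {n} {G : Graph n} → Edit G → Fin n → Fin n → Bool
touched E a b = mem (plus E) a b ∨ mem (minus E) a b

touched-sym : ∀ {n} {G : Graph n} (E : Edit G) a b → touched E a b ≡ touched E b a
touched-sym E a b = cong₂ _∨_ (memSym (plus E) a b) (memSym (minus E) a b)

touched-plus : ∀ {n} {G : Graph n} (E : Edit G) {a b} → In (plus E) a b → touched E a b ≡ true
touched-plus E added rewrite added = refl

touched-minus : ∀ {n} {G : Graph n} (E : Edit G) {a b} → In (minus E) a b → touched E a b ≡ true
touched-minus E {a} {b} deleted rewrite deleted = ∨-zeroʳ (mem (plus E) a b)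

∧-monoʳ-true : ∀ a {b c} → (b ≡ true → c ≡ true) → a ∧ b ≡ true → a ∧ c ≡ true
∧-monoʳ-true true b⇒c ab = b⇒c ab

size-<-ordered : ∀ {n} {G : Graph n} (E₁ E₂ : Edit G) →
                 (∀ a b → touched E₁ a b ≡ true → touched E₂ a b ≡ true) →
                 ∀ {a b} → toℕ a < toℕ b → touched E₂ a b ≡ true → touched E₁ a b ≡ false →
                 size E₁ < size E₂
size-<-ordered {n} E₁ E₂ E₁⊆E₂ {a} {b} a<b t₂ t₁ =
  length-filterᵇ-< _ _ (λ p → ∧-monoʳ-true _ (E₁⊆E₂ (proj₁ p) (proj₂ p)))
    (allPairs n) (∈-allPairs a b) (cong₂ _∧_ a<ᵇb t₂) (cong₂ _∧_ a<ᵇb t₁)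
  where
  a<ᵇb : (toℕ a <ᵇ toℕ b) ≡ true
  a<ᵇb = Equivalence.to T-≡ (<⇒<ᵇ a<b)

size-< : ∀ {n} {G : Graph n} (E₁ E₂ : Edit G) →
         (∀ a b → touched E₁ a b ≡ true → touched E₂ a b ≡ true) →
         ∀ {x y} → x ≢ y → touched E₂ x y ≡ true → touched E₁ x y ≡ false → size E₁ < size E₂
size-< E₁ E₂ E₁⊆E₂ {x} {y} x≢y t₂ t₁ with <-cmp (toℕ x) (toℕ y)
... | tri< x<y _ _ = size-<-ordered E₁ E₂ E₁⊆E₂ x<y t₂ t₁
... | tri≈ _ x≡y _ = ⊥-elim (x≢y (toℕ-injective x≡y))
... | tri> _ _ y<x = size-<-ordered E₁ E₂ E₁⊆E₂ y<x
                       (trans (touched-sym E₂ y x) t₂) (trans (touched-sym E₁ y x) t₁)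

size-undo-< : ∀ {n} {G : Graph n} (E : Edit G) (S : PairSelection n) {x y} →
              x ≢ y → Selected S x y → touched E x y ≡ true → size (undo E S) < size E
size-undo-< E S {x} {y} x≢y sel t = size-< (undo E S) E undo-⊆ x≢y t untouched
  where
  touched-undo : ∀ a b → touched (undo E S) a b ≡ touched E a b ∧ keep S a b
  touched-undo a b = sym (∧-distribʳ-∨ (keep S a b) (mem (plus E) a b) (mem (minus E) a b))
  undo-⊆ : ∀ a b → touched (undo E S) a b ≡ true → touched E a b ≡ true
  undo-⊆ a b t′ = ∧-conicalˡ _ _ (trans (sym (touched-undo a b)) t′)
  untouched : touched (undo E S) x y ≡ false
  untouched rewrite touched-undo x y | dec-true (selected? S x y) sel = ∧-zeroʳ (touched E x y)

diamond-transfer : ∀ {n} {H G : Graph n} {a b c d} →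
  adj H a b ≡ adj G a b → adj H a c ≡ adj G a c → adj H a d ≡ adj G a d →
  adj H b c ≡ adj G b c → adj H b d ≡ adj G b d → adj H c d ≡ adj G c d →
  InducedDiamond H a b c d → InducedDiamond G a b c d
diamond-transfer e-ab e-ac e-ad e-bc e-bd e-cd
                 (a≢b , a≢c , a≢d , b≢c , b≢d , c≢d , ab , ac , ad , bc , bd , cd) =
  a≢b , a≢c , a≢d , b≢c , b≢d , c≢d ,
  trans (sym e-ab) ab , trans (sym e-ac) ac , trans (sym e-ad) ad ,
  trans (sym e-bc) bc , trans (sym e-bd) bd , trans (sym e-cd) cd

-- Then H is diamond-free:
-- two diamond vertices in K would force a, b ∈ K and then c, d ∈ K, but cd is a
-- non-edge; so no pair of the diamond lies inside K and it is a diamond of G′.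
diamond-free-clique-reset : ∀ {n} {H G′ : Graph n} {K : Subset n} →
  DiamondFree G′ → (∀ a b → ¬ (a ∈ K × b ∈ K) → adj H a b ≡ adj G′ a b) →
  IsClique H K → AtMostOneNeighbourIn G′ K → DiamondFree H
diamond-free-clique-reset {H = H} {G′} {K} dfG′ agree clK one a b c d
  diamond@(a≢b , a≢c , a≢d , b≢c , b≢d , c≢d , ab , ac , ad , bc , bd , cd) =
  dfG′ a b c d (diamond-transfer {H = H} {G′}
                  (agree a b ¬ab) (agree a c ¬ac) (agree a d ¬ad)
                  (agree b c ¬bc) (agree b d ¬bd) (agree c d ¬cd) diamond)
  where
  common : ∀ {p q r} → p ≢ q → p ∈ K → q ∈ K → Adj H p r → Adj H q r → r ∈ K
  common {p} {q} {r} p≢q pK qK pr qr with r ∈? K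
  ... | yes rK = rK
  ... | no r∉K = ⊥-elim (one p q r p≢q pK qK r∉K (outside pr) (outside qr))
    where
    outside : ∀ {s} → Adj H s r → Adj G′ s r
    outside sr = trans (sym (agree _ r (r∉K ∘ proj₂))) sr
  ¬cd : ¬ (c ∈ K × d ∈ K)
  ¬cd (cK , dK) = bool-clash (clK c d cK dK c≢d) cd
  ¬ab : ¬ (a ∈ K × b ∈ K)
  ¬ab (aK , bK) = ¬cd (common a≢b aK bK ac bc , common a≢b aK bK ad bd)
  ¬ac : ¬ (a ∈ K × c ∈ K)
  ¬ac (aK , cK) = ¬ab (aK , common a≢c aK cK ab (adj-sym H bc))
  ¬ad : ¬ (a ∈ K × d ∈ K)
  ¬ad (aK , dK) = ¬ab (aK , common a≢d aK dK ab (adj-sym H bd))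
  ¬bc : ¬ (b ∈ K × c ∈ K)
  ¬bc (bK , cK) = ¬ab (common b≢c bK cK (adj-sym H ab) (adj-sym H ac) , bK)
  ¬bd : ¬ (b ∈ K × d ∈ K)
  ¬bd (bK , dK) = ¬ab (common b≢d bK dK (adj-sym H ab) (adj-sym H ad) , bK)

-- Let H agree with a diamond-free G′ on all pairs avoiding u, and let u be
-- isolated in H.  Then H is diamond-free, since every diamond vertex has a neighbour.
diamond-free-isolate : ∀ {n} {H G′ : Graph n} {u : Fin n} →
  DiamondFree G′ → (∀ a b → a ≢ u → b ≢ u → adj H a b ≡ adj G′ a b) →
  (∀ z → adj H u z ≡ false) → DiamondFree H
diamond-free-isolate {H = H} {G′} {u} dfG′ agree isolated a b c d
  diamond@(_ , _ , _ , _ , _ , _ , ab , ac , ad , _ , _ , _) =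
  dfG′ a b c d (diamond-transfer {H = H} {G′}
                  (agree a b a≢u b≢u) (agree a c a≢u c≢u) (agree a d a≢u d≢u)
                  (agree b c b≢u c≢u) (agree b d b≢u d≢u) (agree c d c≢u d≢u) diamond)
  where
  has-neighbour : ∀ {x z} → Adj H x z → x ≢ u
  has-neighbour xz refl = bool-clash xz (isolated _)
  a≢u : a ≢ u
  a≢u = has-neighbour ab
  b≢u : b ≢ u
  b≢u = has-neighbour (adj-sym H ab)
  c≢u : c ≢ u
  c≢u = has-neighbour (adj-sym H ac)
  d≢u : d ≢ u
  d≢u = has-neighbour (adj-sym H ad)

-- Exchange arguments against a minimum solution E±: undoing E on the selected
-- pairs shrinks the edit, so the result can never be diamond-free.
module MinimumSolution {n : ℕ} {G : Graph n} {k : ℕ} {E : Edit G}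
                       (minE : IsMinimumSolution G k E) where

  dfGE : DiamondFree (G △ E)
  dfGE = proj₁ (proj₁ minE)

  undo-not-diamond-free : ∀ (S : PairSelection n) {x y} → x ≢ y → Selected S x y →
                          touched E x y ≡ true → ¬ DiamondFree (G △ undo E S)
  undo-not-diamond-free S x≢y sel t df =
    <⇒≱ smaller (proj₂ minE (undo E S) (df , ≤-trans (<⇒≤ smaller) (proj₂ (proj₁ minE))))
    where
    smaller : size (undo E S) < size E
    smaller = size-undo-< E S x≢y sel t

  -- If K is a clique of G with the one-neighbour property in G △ E±, no edge
  -- inside K is deleted: restoring the pairs inside K stays diamond-free.
  no-deletion-inside : ∀ {K} → IsClique G K → AtMostOneNeighbourIn (G △ E) K →
                       ∀ x y → x ∈ K → y ∈ K → ¬ In (minus E) x y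
  no-deletion-inside {K} clK one x y xK yK deleted =
    undo-not-diamond-free inside x≢y (xK , yK) (touched-minus E deleted)
      (diamond-free-clique-reset {H = G △ undo E inside} {G △ E} dfGE
                                 (λ a b → undo-unselected E inside) clH one)
    where
    inside : PairSelection n
    inside = record { Selected = λ a b → a ∈ K × b ∈ K
                    ; selected? = λ a b → a ∈? K ×-dec b ∈? K
                    ; swap-sel = swap }
    x≢y : x ≢ y
    x≢y refl = bool-clash deleted (memIrr (minus E) x)
    clH : IsClique (G △ undo E inside) K
    clH a b aK bK a≢b = trans (undo-selected E inside (aK , bK)) (clK a b aK bK a≢b)

  -- No edge is added at a vertex u isolated in G: undoing the pairs at u
  -- leaves u isolated and stays diamond-free.
  no-isolated-addition : ∀ u w → (∀ z → adj G u z ≡ false) → ¬ In (plus E) u w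
  no-isolated-addition u w isolated added =
    undo-not-diamond-free at-u u≢w (inj₁ refl) (touched-plus E added)
      (diamond-free-isolate {H = G △ undo E at-u} {G △ E} dfGE
         (λ a b a≢u b≢u → undo-unselected E at-u Sum.[ a≢u , b≢u ])
         (λ z → trans (undo-selected E at-u (inj₁ refl)) (isolated z)))
    where
    at-u : PairSelection n
    at-u = record { Selected = λ a b → a ≡ u ⊎ b ≡ u
                  ; selected? = λ a b → (a ≟ u) ⊎-dec (b ≟ u)
                  ; swap-sel = Sum.swap }
    u≢w : u ≢ w
    u≢w refl = bool-clash added (memIrr (plus E) u)

-- Conditions (i) and (ii) transfer the one-neighbour property from G to G △ E±:
-- of two edges from K to an outside vertex w, an added one is excluded by (i)
-- if the other is old (then w ∈ N(K)), and by (ii) if both are added.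
one-neighbour-preserved : ∀ {n} {G : Graph n} (E : Edit G) {K} → AtMostOneNeighbourIn G K →
  (∀ u v → u ∈ K → InNbhd G K v → ¬ In (plus E) u v) →
  (∀ u₁ u₂ w → u₁ ≢ u₂ → u₁ ∈ K → u₂ ∈ K → w ∉ K → ¬ (In (plus E) u₁ w × In (plus E) u₂ w)) →
  AtMostOneNeighbourIn (G △ E) K
one-neighbour-preserved E one no-neighbour-addition no-shared-addition u v w u≢v uK vK w∉K uw vw
  with edge-origin E uw | edge-origin E vw
... | inj₁ old-uw | inj₁ old-vw = one u v w u≢v uK vK w∉K old-uw old-vw
... | inj₁ old-uw | inj₂ new-vw = no-neighbour-addition v w vK (w∉K , u , uK , old-uw) new-vw
... | inj₂ new-uw | inj₁ old-vw = no-neighbour-addition u w uK (w∉K , v , vK , old-vw) new-uw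
... | inj₂ new-uw | inj₂ new-vw = no-shared-addition u v w u≢v uK vK w∉K (new-uw , new-vw)

sole-or-other : ∀ {n} (K : Subset n) x → (∀ v → v ∈ K → v ≡ x) ⊎ ∃[ v ] (v ∈ K × v ≢ x)
sole-or-other {n} K x with all? (λ v → v ∈? K →-dec v ≟ x)
... | yes sole = inj₁ sole
... | no ¬sole with v , ¬soleᵥ ← ¬∀⟶∃¬ n _ (λ v → v ∈? K →-dec v ≟ x) ¬sole =
  inj₂ (v , ¬→-split (v ∈? K) ¬soleᵥ)

-- A vertex y
-- joining K in G △ E± has a non-neighbour x ∈ K in G, so xy is added; then K has
-- a second vertex v (x is not isolated), and x, v are two neighbours of y.
maximal-preserved : ∀ {n} {G : Graph n} (E : Edit G) {K} → IsMaximalClique G K →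
  AtMostOneNeighbourIn (G △ E) K →
  (∀ u w → (∀ z → adj G u z ≡ false) → ¬ In (plus E) u w) →
  ∀ K′ → IsClique (G △ E) K′ → K ⊆ K′ → K′ ⊆ K
maximal-preserved {G = G} E {K} maxK one′ no-isolated-addition K′ clK′ K⊆K′ {y} yK′ with y ∈? K
... | yes yK = yK
... | no y∉K with x , xK , x≢y , ¬xy ← Cliques.blocked-outside G maxK y∉K
             with edge-origin E (clK′ x y (K⊆K′ xK) yK′ x≢y)
...   | inj₁ old-xy = ⊥-elim (bool-clash old-xy ¬xy)
...   | inj₂ new-xy with sole-or-other K x
...     | inj₁ sole =
          ⊥-elim (no-isolated-addition x y (Cliques.sole-vertex-isolated G maxK sole) new-xy)
...     | inj₂ (v , vK , v≢x) = ⊥-elim (one′ x v y (v≢x ∘ sym) xK vK y∉K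
                                  (clK′ x y (K⊆K′ xK) yK′ x≢y)
                                  (clK′ v y (K⊆K′ vK) yK′ (λ v≡y → y∉K (subst (_∈ K) v≡y vK))))

lemma8 : {n : ℕ} (G : Graph n) (k : ℕ) (E : Edit G) (K : Subset n)
    → IsMinimumSolution G k E
    → TypeII G K
    → (∀ u v → u ∈ K → InNbhd G K v → ¬ In (plus E) u v)
    → (∀ u₁ u₂ w → u₁ ≢ u₂ → u₁ ∈ K → u₂ ∈ K → w ∉ K → ¬ (In (plus E) u₁ w × In (plus E) u₂ w))
    → TypeII (G △ E) K
lemma8 G k E K minE typeII no-neighbour-addition no-shared-addition =
  one-neighbour⇒typeII {G = G △ E}
    (clique′ , maximal-preserved E maxK one′ no-isolated-addition) one′
  where
  open MinimumSolution {G = G} {k = k} {E = E} minE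
    using (no-deletion-inside; no-isolated-addition)
  maxK : IsMaximalClique G K
  maxK = proj₁ typeII
  one′ : AtMostOneNeighbourIn (G △ E) K
  one′ = one-neighbour-preserved E (typeII⇒one-neighbour {G = G} typeII)
           no-neighbour-addition no-shared-addition
  clique′ : IsClique (G △ E) K
  clique′ a b aK bK a≢b =
    edge-kept E (proj₁ maxK a b aK bK a≢b) (no-deletion-inside (proj₁ maxK) one′ a b aK bK)
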